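{- Let $S\subseteq\mathbb N^d$ be a good semigroup, $E\subseteq S$ a good ideal with conductor $c_E=(c_1,\dots,c_d)$, and $\alpha\in\mathbb N^d$. Suppose $c_E\in\Delta^E_F(\alpha)$ for some nonempty $F\subsetneq I$ (i.e. $\alpha_i=c_i$ for $i\in F$ and $\alpha_j<c_j$ for $j\notin F$). The following are equivalent: (1) $\alpha\in E$; (2) $\widetilde\Delta_{\widehat F}(\alpha)\subseteq E$; (3) $\widetilde\Delta^E_{\widehat F}(\alpha)\ne\emptyset$.
   Context: $I=\{1,\dots,d\}$, $\le$ componentwise order, $\wedge$ componentwise minimum, $\widehat F=I\setminus F$. A good semigroup is a submonoid $S$ of $(\mathbb N^d,+)$ with (G1) $\alpha\wedge\beta\in S$ for $\alpha,\beta\in S$; (G2) if $\alpha,\beta\in S$, $\alpha\ne\beta$, $\alpha_i=\beta_i$, there is $\epsilon\in S$ with $\epsilon_i>\alpha_i$, $\epsilon_j\ge\min(\alpha_j,\beta_j)$ for $j\ne i$, with equality when $\alpha_j\ne\beta_j$; (G3) some $c\in S$ has $c+\mathbb N^d\subseteq S$. A good ideal is $E\subseteq S$ with $E+S\subseteq E$ satisfying (G1),(G2) inside $E$; its conductor is $c_E=\min\{\alpha\in\mathbb N^d:\alpha+\mathbb N^d\subseteq E\}$. For $X\subseteq\mathbb N^d$: $\Delta^X_F(\alpha)=\{\beta\in X:\beta_i=\alpha_i\ (i\in F),\ \beta_j>\alpha_j\ (j\notin F)\}$, $\widetilde\Delta^X_F(\alpha)=\{\beta\in X:\beta_i=\alpha_i\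 (i\in F),\ \beta_j\ge\alpha_j\ (j\notin F)\}\setminus\{\alpha\}$; superscript omitted for $X=\mathbb N^d$. -}

module Defs where

open import Data.Unit using (⊤)
open import Data.Nat using (ℕ; _+_; _≤_; _<_; _⊓_)
open import Data.Fin using (Fin)
open import Data.Fin.Subset using (Subset; _∈_; _∉_)
open import Data.Vec using (Vec; lookup; zipWith; replicate)
open import Data.Product using (_×_; ∃; ∃-syntax)
open import Relation.Binary.PropositionalEquality using (_≡_)
open import Relation.Nullary using (¬_)

ℕ^ : ℕ → Set
ℕ^ d = Vec ℕ d

SubsetOf : ℕ → Set₁
SubsetOf d = ℕ^ d → Set

module _ {d : ℕ} where

  _≤ᵛ_ : ℕ^ d → ℕ^ d → Set
  α ≤ᵛ β = ∀ i → lookup α i ≤ lookup β i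

  _∧ᵛ_ : ℕ^ d → ℕ^ d → ℕ^ d
  α ∧ᵛ β = zipWith _⊓_ α β

  _+ᵛ_ : ℕ^ d → ℕ^ d → ℕ^ d
  α +ᵛ β = zipWith _+_ α β

  0ᵛ : ℕ^ d
  0ᵛ = replicate d 0

  G1 : SubsetOf d → Set
  G1 X = ∀ α β → X α → X β → X (α ∧ᵛ β)

  G2 : SubsetOf d → Set
  G2 X = ∀ α β (i : Fin d) → X α → X β → ¬ (α ≡ β) → lookup α i ≡ lookup β i →
    ∃[ ε ] (X ε × lookup α i < lookup ε i ×
      (∀ j → ¬ (j ≡ i) →
        (lookup α j ⊓ lookup β j ≤ lookup ε j) ×
        (¬ (lookup α j ≡ lookup β j) → lookup ε j ≡ lookup α j ⊓ lookup β j)))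

  G3 : SubsetOf d → Set
  G3 X = ∃[ c ] (X c × (∀ β → c ≤ᵛ β → X β))

  record IsGoodSemigroup (S : SubsetOf d) : Set where
    field
      zero-∈ : S 0ᵛ
      +-closed : ∀ α β → S α → S β → S (α +ᵛ β)
      g1 : G1 S
      g2 : G2 S
      g3 : G3 S

  record IsGoodIdeal (S E : SubsetOf d) : Set where
    field
      ⊆S : ∀ α → E α → S α
      ideal : ∀ α β → E α → S β → E (α +ᵛ β)
      g1 : G1 E
      g2 : G2 E

  IsConductor : SubsetOf d → ℕ^ d → Set
  IsConductor E c = (∀ β → c ≤ᵛ β → E β) ×
                    (∀ γ → (∀ β → γ ≤ᵛ β → E β) → c ≤ᵛ γ)

  Δ : SubsetOf d → Subset d → ℕ^ d → SubsetOf d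
  Δ X F α β = X β × (∀ i → i ∈ F → lookup β i ≡ lookup α i)
                  × (∀ j → j ∉ F → lookup α j < lookup β j)

  Δ̃ : SubsetOf d → Subset d → ℕ^ d → SubsetOf d
  Δ̃ X F α β = X β × (∀ i → i ∈ F → lookup β i ≡ lookup α i)
                   × (∀ j → j ∉ F → lookup α j ≤ lookup β j) × ¬ (β ≡ α)

  Univ : SubsetOf d
  Univ _ = ⊤

module Submission where

-- For β ∈ Δ̃^E_F̂(α) one has β ∧ c = α, which gives (3) ⇒ (1); α + e_k with k ∈ F
-- gives (2) ⇒ (3). For (1) ⇒ (2): inside E, a coordinate k with γ_k ≥ c_k can be
-- moved to any value ≥ c_k without touching the others, provided d ≥ 2. Applying
-- G2 to γ and a point of c + ℕ^d that agrees with γ only at k raises γ_k by one,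
-- and a meet with a point of c + ℕ^d lowers it. Moving the coordinates in F one
-- at a time turns α into any β ∈ Δ̃_F̂(α).

open import Defs
open import Data.Nat using (ℕ; zero; suc; _+_; _≤_; _<_; _⊓_; s≤s)
open import Data.Nat.Properties
  using (≤-reflexive; +-identityʳ; ≤-trans; <⇒≤; <⇒≢; <-≤-trans; n≤1+n; m≤m+n; m≤n+m; +-suc;
         1+n≢n; m≤n⇒m⊓n≡m; m≥n⇒m⊓n≡n)
open import Data.Fin using (Fin; _≟_)
open import Data.Fin.Subset using (Subset; _∈_; _∉_; ∁)
open import Data.Fin.Subset.Properties using (_∈?_; x∉p⇒x∈∁p; x∈∁p⇒x∉p; x∈p⇒x∉∁p)
open import Data.List using (List; []; _∷_; allFin)
open import Data.List.Membership.Propositional using () renaming (_∈_ to _∈ˡ_)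
open import Data.List.Membership.Propositional.Properties using (∈-allFin)
open import Data.List.Relation.Unary.Any using (here; there)
open import Data.Product using (_×_; ∃-syntax; _,_; proj₁; proj₂)
open import Data.Sum using (_⊎_; inj₁; inj₂)
open import Data.Unit using (tt)
open import Data.Vec using (Vec; lookup; zipWith; _[_]≔_)
open import Data.Vec.Properties
  using (tabulate∘lookup; tabulate-cong; lookup∘update; lookup∘update′; lookup-zipWith; []≔-lookup)
open import Function.Base using (_∘_)
open import Function.Bundles using (_⇔_; mk⇔)
open import Level using (Level)
open import Relation.Binary.PropositionalEquality
  using (_≡_; _≢_; _≗_; refl; sym; trans; cong; subst)
open import Relation.Nullary using (yes; no)

private
  variable
    a ℓ : Level
    A : Set a
    n : ℕ

lookup-≗⇒≡ : {xs ys : Vec A n} → lookup xs ≗ lookup ys → xs ≡ ys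
lookup-≗⇒≡ {xs = xs} {ys} eq =
  trans (sym (tabulate∘lookup xs)) (trans (tabulate-cong eq) (tabulate∘lookup ys))

[]≔-cong-off : {xs ys : Vec A n} (k : Fin n) (v : A) →
  (∀ i → i ≢ k → lookup xs i ≡ lookup ys i) → xs [ k ]≔ v ≡ ys [ k ]≔ v
[]≔-cong-off {xs = xs} {ys} k v agree = lookup-≗⇒≡ pointwise
  where
  pointwise : ∀ i → lookup (xs [ k ]≔ v) i ≡ lookup (ys [ k ]≔ v) i
  pointwise i with i ≟ k
  ... | yes refl = trans (lookup∘update k xs v) (sym (lookup∘update k ys v))
  ... | no i≢k =
    trans (lookup∘update′ i≢k xs v) (trans (agree i i≢k) (sym (lookup∘update′ i≢k ys v)))

MixOf : {A : Set a} → Vec A n → Vec A n → Vec A n → Set a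
MixOf γ β v = ∀ i → lookup v i ≡ lookup γ i ⊎ lookup v i ≡ lookup β i

≡⊎≡-subst : (P : A → Set ℓ) {x y z : A} → x ≡ y ⊎ x ≡ z → P y → P z → P x
≡⊎≡-subst P (inj₁ x≡y) Py _  = subst P (sym x≡y) Py
≡⊎≡-subst P (inj₂ x≡z) _  Pz = subst P (sym x≡z) Pz

overwrite : List (Fin n) → Vec A n → Vec A n → Vec A n
overwrite []       γ β = γ
overwrite (k ∷ ks) γ β = overwrite ks γ β [ k ]≔ lookup β k

overwrite-MixOf : ∀ (ks : List (Fin n)) (γ β : Vec A n) → MixOf γ β (overwrite ks γ β)
overwrite-MixOf []       γ β i = inj₁ refl
overwrite-MixOf (k ∷ ks) γ β i with i ≟ k
... | yes refl = inj₂ (lookup∘update k (overwrite ks γ β) (lookup β k))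
... | no i≢k with overwrite-MixOf ks γ β i
...   | inj₁ eq = inj₁ (trans (lookup∘update′ i≢k (overwrite ks γ β) (lookup β k)) eq)
...   | inj₂ eq = inj₂ (trans (lookup∘update′ i≢k (overwrite ks γ β) (lookup β k)) eq)

lookup-overwrite-∈ : ∀ {ks : List (Fin n)} {i} (γ β : Vec A n) → i ∈ˡ ks →
  lookup (overwrite ks γ β) i ≡ lookup β i
lookup-overwrite-∈ {ks = k ∷ ks} γ β (here refl) = lookup∘update k (overwrite ks γ β) (lookup β k)
lookup-overwrite-∈ {ks = k ∷ ks} {i} γ β (there i∈ks) with i ≟ k
... | yes refl = lookup∘update k (overwrite ks γ β) (lookup β k)
... | no i≢k =
  trans (lookup∘update′ i≢k (overwrite ks γ β) (lookup β k)) (lookup-overwrite-∈ γ β i∈ks)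

overwrite-allFin : (γ β : Vec A n) → overwrite (allFin n) γ β ≡ β
overwrite-allFin γ β = lookup-≗⇒≡ (λ i → lookup-overwrite-∈ γ β (∈-allFin i))

overwrite-induction : (P : Vec A n → Set ℓ) {γ β : Vec A n} → P γ →
  (∀ v k → MixOf γ β v → P v → P (v [ k ]≔ lookup β k)) → P β
overwrite-induction {n = n} P {γ} {β} Pγ step =
  subst P (overwrite-allFin γ β) (go (allFin n))
  where
  go : ∀ ks → P (overwrite ks γ β)
  go []       = Pγ
  go (k ∷ ks) = step _ k (overwrite-MixOf ks γ β) (go ks)

module UpClosed {d : ℕ} {E : SubsetOf d} (g1 : G1 E) (g2 : G2 E) {c : ℕ^ d}
                (c≤⇒∈E : ∀ β → c ≤ᵛ β → E β) where

  beyond : ℕ^ d → ℕ^ d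
  beyond γ = zipWith (λ x y → suc (x + y)) γ c

  <-beyond : ∀ γ i → lookup γ i < lookup (beyond γ) i
  <-beyond γ i = subst (lookup γ i <_) (sym (lookup-zipWith _ i γ c)) (s≤s (m≤m+n _ _))

  c≤beyond : ∀ γ i → lookup c i ≤ lookup (beyond γ) i
  c≤beyond γ i = subst (lookup c i ≤_) (sym (lookup-zipWith _ i γ c))
    (≤-trans (m≤n+m _ _) (n≤1+n _))

  beyond[]≔∈E : ∀ γ k v → lookup c k ≤ v → E (beyond γ [ k ]≔ v)
  beyond[]≔∈E γ k v ck≤v = c≤⇒∈E _ above
    where
    above : c ≤ᵛ (beyond γ [ k ]≔ v)
    above i with i ≟ k
    ... | yes refl = subst (lookup c i ≤_) (sym (lookup∘update k (beyond γ) v)) ck≤v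
    ... | no i≢k = subst (lookup c i ≤_) (sym (lookup∘update′ i≢k (beyond γ) v)) (c≤beyond γ i)

  <-beyond[]≔ : ∀ γ {k i} v → i ≢ k → lookup γ i < lookup (beyond γ [ k ]≔ v) i
  <-beyond[]≔ γ {i = i} v i≢k =
    subst (lookup γ i <_) (sym (lookup∘update′ i≢k (beyond γ) v)) (<-beyond γ i)

  lower-coordinate : ∀ {ε k v} → E ε → lookup c k ≤ v → v ≤ lookup ε k → E (ε [ k ]≔ v)
  lower-coordinate {ε} {k} {v} Eε ck≤v v≤εk =
    subst E (lookup-≗⇒≡ meet) (g1 ε (beyond ε [ k ]≔ v) Eε (beyond[]≔∈E ε k v ck≤v))
    where
    meet : ∀ i → lookup (ε ∧ᵛ (beyond ε [ k ]≔ v)) i ≡ lookup (ε [ k ]≔ v) i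
    meet i rewrite lookup-zipWith _⊓_ i ε (beyond ε [ k ]≔ v) with i ≟ k
    ... | yes refl rewrite lookup∘update k (beyond ε) v | lookup∘update k ε v = m≥n⇒m⊓n≡n v≤εk
    ... | no i≢k rewrite lookup∘update′ i≢k (beyond ε) v | lookup∘update′ i≢k ε v =
      m≤n⇒m⊓n≡m (<⇒≤ (<-beyond ε i))

  -- G2 applied to γ and δ, which agree only at k; the coordinate j ≢ k makes them distinct.
  raise-coordinate-once : ∀ {γ k j} → j ≢ k → E γ → lookup c k ≤ lookup γ k →
    ∃[ ε ] E ε × lookup γ k < lookup ε k × (∀ i → i ≢ k → lookup ε i ≡ lookup γ i)
  raise-coordinate-once {γ} {k} {j} j≢k Eγ ck≤γk
    with g2 γ δ k Eγ (beyond[]≔∈E γ k (lookup γ k) ck≤γk) γ≢δ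
            (sym (lookup∘update k (beyond γ) (lookup γ k)))
    where
    δ : ℕ^ d
    δ = beyond γ [ k ]≔ lookup γ k
    γ≢δ : γ ≢ δ
    γ≢δ γ≡δ = <⇒≢ (<-beyond[]≔ γ _ j≢k) (cong (λ v → lookup v j) γ≡δ)
  ... | ε , Eε , γk<εk , off-k = ε , Eε , γk<εk , unchanged
    where
    unchanged : ∀ i → i ≢ k → lookup ε i ≡ lookup γ i
    unchanged i i≢k = trans (proj₂ (off-k i i≢k) (<⇒≢ γi<δi)) (m≤n⇒m⊓n≡m (<⇒≤ γi<δi))
      where
      γi<δi : lookup γ i < lookup (beyond γ [ k ]≔ lookup γ k) i
      γi<δi = <-beyond[]≔ γ _ i≢k

  raise-coordinate : ∀ {γ k j} → j ≢ k → E γ → lookup c k ≤ lookup γ k → ∀ m →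
    ∃[ ε ] E ε × lookup γ k + m ≤ lookup ε k × (∀ i → i ≢ k → lookup ε i ≡ lookup γ i)
  raise-coordinate {γ} j≢k Eγ ck≤γk zero = γ , Eγ , ≤-reflexive (+-identityʳ _) , λ _ _ → refl
  raise-coordinate {k = k} j≢k Eγ ck≤γk (suc m)
    with raise-coordinate j≢k Eγ ck≤γk m
  ... | ε , Eε , γk+m≤εk , off-k
    with raise-coordinate-once j≢k Eε (≤-trans ck≤γk (≤-trans (m≤m+n _ m) γk+m≤εk))
  ... | ε′ , Eε′ , εk<ε′k , off-k′ =
    ε′ , Eε′ , subst (_≤ lookup ε′ k) (sym (+-suc _ m)) (<-≤-trans (s≤s γk+m≤εk) εk<ε′k) ,
    λ i i≢k → trans (off-k′ i i≢k) (off-k i i≢k)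

  set-coordinate : ∀ {γ k j v} → j ≢ k → E γ → lookup c k ≤ lookup γ k → lookup c k ≤ v →
    E (γ [ k ]≔ v)
  set-coordinate {k = k} {v = v} j≢k Eγ ck≤γk ck≤v with raise-coordinate j≢k Eγ ck≤γk v
  ... | ε , Eε , γk+v≤εk , off-k =
    subst E ([]≔-cong-off k v off-k) (lower-coordinate Eε ck≤v (≤-trans (m≤n+m v _) γk+v≤εk))

  vary-above-conductor : ∀ {F : Subset d} {j γ β} → j ∉ F → E γ →
    (∀ i → i ∈ F → lookup c i ≤ lookup γ i × lookup c i ≤ lookup β i) →
    (∀ i → i ∉ F → lookup γ i ≡ lookup β i) → E β
  vary-above-conductor {F} {γ = γ} {β} j∉F Eγ above off-F = overwrite-induction E Eγ step
    where
    step : ∀ v k → MixOf γ β v → E v → E (v [ k ]≔ lookup β k)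
    step v k mix Ev with k ∈? F
    ... | yes k∈F = set-coordinate (λ j≡k → j∉F (subst (_∈ F) (sym j≡k) k∈F)) Ev
      (≡⊎≡-subst (lookup c k ≤_) (mix k) (proj₁ (above k k∈F)) (proj₂ (above k k∈F)))
      (proj₂ (above k k∈F))
    ... | no k∉F = subst E (sym (trans (cong (v [ k ]≔_) (sym vk≡βk)) ([]≔-lookup v k))) Ev
      where
      vk≡βk : lookup v k ≡ lookup β k
      vk≡βk = ≡⊎≡-subst (_≡ lookup β k) (mix k) (off-F k k∉F) refl

  ∈E⇒Δ̃ᶜ⊆E : ∀ {F : Subset d} {j α} → j ∉ F → (∀ i → i ∈ F → lookup c i ≡ lookup α i) →
    E α → ∀ β → Δ̃ Univ (∁ F) α β → E β
  ∈E⇒Δ̃ᶜ⊆E {F} j∉F c≡α Eα β (_ , off-F , on-F , _) = vary-above-conductor j∉F Eα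
    (λ i i∈F → ≤-reflexive (c≡α i i∈F) , c≤β i i∈F)
    (λ i i∉F → sym (off-F i (x∉p⇒x∈∁p i∉F)))
    where
    c≤β : ∀ i → i ∈ F → lookup c i ≤ lookup β i
    c≤β i i∈F = ≤-trans (≤-reflexive (c≡α i i∈F)) (on-F i (x∈p⇒x∉∁p i∈F))

Δ̃ᶜ-∧ᵛ-conductor : ∀ {d} {X : SubsetOf d} {F : Subset d} {c α β : ℕ^ d} →
  (∀ i → i ∈ F → lookup c i ≡ lookup α i) → (∀ j → j ∉ F → lookup α j < lookup c j) →
  Δ̃ X (∁ F) α β → β ∧ᵛ c ≡ α
Δ̃ᶜ-∧ᵛ-conductor {F = F} {c} {α} {β} c≡α α<c (_ , off-F , on-F , _) =
  lookup-≗⇒≡ λ i → trans (lookup-zipWith _⊓_ i β c) (meet i)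
  where
  meet : ∀ i → lookup β i ⊓ lookup c i ≡ lookup α i
  meet i with i ∈? F
  ... | yes i∈F =
    trans (m≥n⇒m⊓n≡n (≤-trans (≤-reflexive (c≡α i i∈F)) (on-F i (x∈p⇒x∉∁p i∈F)))) (c≡α i i∈F)
  ... | no i∉F =
    trans (cong (_⊓ lookup c i) (off-F i (x∉p⇒x∈∁p i∉F))) (m≤n⇒m⊓n≡m (<⇒≤ (α<c i i∉F)))

[]≔suc∈Δ̃ᶜ : ∀ {d} {F : Subset d} {α k} → k ∈ F → Δ̃ Univ (∁ F) α (α [ k ]≔ suc (lookup α k))
[]≔suc∈Δ̃ᶜ {F = F} {α} {k} k∈F = tt , off-F , on-F , changed
  where
  off-F : ∀ i → i ∈ ∁ F → lookup (α [ k ]≔ suc (lookup α k)) i ≡ lookup α i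
  off-F i i∈∁F = lookup∘update′ (λ i≡k → x∈∁p⇒x∉p i∈∁F (subst (_∈ F) (sym i≡k) k∈F)) α _
  on-F : ∀ i → i ∉ ∁ F → lookup α i ≤ lookup (α [ k ]≔ suc (lookup α k)) i
  on-F i _ with i ≟ k
  ... | yes refl = subst (lookup α i ≤_) (sym (lookup∘update k α _)) (n≤1+n _)
  ... | no i≢k = ≤-reflexive (sym (lookup∘update′ i≢k α _))
  changed : α [ k ]≔ suc (lookup α k) ≢ α
  changed eq = 1+n≢n (trans (sym (lookup∘update k α _)) (cong (λ v → lookup v k) eq))

proposition1p8 : (d : ℕ) (S E : SubsetOf d) (c α : ℕ^ d) (F : Subset d) →
    IsGoodSemigroup S → IsGoodIdeal S E → IsConductor E c →
    (∃[ i ] (i ∈ F)) → (∃[ j ] (j ∉ F)) →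
    Δ E F α c →
    (E α ⇔ (∀ β → Δ̃ Univ (∁ F) α β → E β)) ×
    (E α ⇔ (∃[ β ] Δ̃ E (∁ F) α β))
proposition1p8 d S E c α F _ gi (c≤⇒∈E , _) (k , k∈F) (j , j∉F) (Ec , c≡α , α<c) =
  mk⇔ one⇒two (three⇒one ∘ two⇒three) ,
  mk⇔ (two⇒three ∘ one⇒two) three⇒one
  where
  open IsGoodIdeal gi using (g1; g2)
  open UpClosed g1 g2 {c} c≤⇒∈E using (∈E⇒Δ̃ᶜ⊆E)

  one⇒two : E α → ∀ β → Δ̃ Univ (∁ F) α β → E β
  one⇒two = ∈E⇒Δ̃ᶜ⊆E j∉F c≡α

  two⇒three : (∀ β → Δ̃ Univ (∁ F) α β → E β) → ∃[ β ] Δ̃ E (∁ F) α β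
  two⇒three Δ̃⊆E = _ , Δ̃⊆E _ α+eₖ , proj₂ α+eₖ
    where
    α+eₖ : Δ̃ Univ (∁ F) α (α [ k ]≔ suc (lookup α k))
    α+eₖ = []≔suc∈Δ̃ᶜ k∈F

  three⇒one : ∃[ β ] Δ̃ E (∁ F) α β → E α
  three⇒one (β , Δ̃β@(Eβ , _)) = subst E (Δ̃ᶜ-∧ᵛ-conductor {X = E} c≡α α<c Δ̃β) (g1 β c Eβ Ec)
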